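{- For every fixed positive integer $k$, $\beta_{m,k}\in 1-\Omega\!\left(\frac{1}{\sqrt[k]{m}}\right)$ as $m\to\infty$; that is, there is a constant $c_k>0$ such that $\beta_{m,k}\le 1-c_k m^{ -1/k}$ for all $m\ge k$.
   Context: For a family of subsets of a set $X$, a hitting set is a subset $Y\subseteq X$ meeting every member of the family. For a positive integer $m$ and $k\in\{1,\dots,m\}$, $\beta_{m,k}$ is the smallest real number $\beta$ such that: for any finite set $X$ and any $m$ subsets $A_1,\dots,A_m$ of $X$ with $|A_i|>\beta|X|$ for all $i$, there is a hitting set for $\{A_1,\dots,A_m\}$ of size at most $k$. -}

module Defs where

open import Data.Nat using (ℕ; _≤_; _<_; _*_; _^_; _∸_)
open import Data.Fin using (Fin)
open import Data.Fin.Subset using (Subset; _∈_; ∣_∣)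
open import Data.Product using (∃; _×_)

Family : ℕ → ℕ → Set
Family m n = Fin m → Subset n

IsHittingSet : ∀ {m n} → Family m n → Subset n → Set
IsHittingSet {m} A Y = ∀ (i : Fin m) → ∃ λ x → x ∈ Y × x ∈ A i

HasHittingSetOfSize≤ : ∀ {m n} → ℕ → Family m n → Set
HasHittingSetOfSize≤ {n = n} k A = ∃ λ (Y : Subset n) → ∣ Y ∣ ≤ k × IsHittingSet A Y

-- For c = p / q (p, q positive naturals), a set S ⊆ X = Fin n satisfies
--   |S| > (1 - c m^{-1/k}) |X|
-- iff  (n - |S|) < c m^{-1/k} n  iff  q^k * m * (n - |S|)^k < p^k * n^k
-- (both sides nonnegative, raising to the k-th power is monotone).
LargeSet : (k m p q n : ℕ) → Subset n → Set
LargeSet k m p q n S = q ^ k * m * (n ∸ ∣ S ∣) ^ k < p ^ k * n ^ k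

-- β_{m,k} ≤ 1 - (p/q) m^{-1/k}: every family of m sets of size
-- > (1 - (p/q) m^{-1/k}) |X| in any finite set X has a hitting set of size ≤ k.
BetaAtMost : (m k p q : ℕ) → Set
BetaAtMost m k p q =
  ∀ (n : ℕ) (A : Family m n) →
  (∀ i → LargeSet k m p q n (A i)) → HasHittingSetOfSize≤ k A

module Submission where

-- Take c_k = 1 and let D bound the number of points each set misses, so that m D^k < n^k.
-- A point x missed by the fewest sets is, by averaging, missed by r′ sets with n r′ ≤ m D,
-- hence r′ D^(k-1) < n^(k-1): by induction on k those r′ sets are hit by k - 1 points,
-- and adding x hits all the others.

open import Defs
open import Data.Nat using (ℕ; zero; suc; _+_; _*_; _^_; _≤_; _<_; z≤n; s≤s)
open import Data.Nat.Properties
open import Data.Bool using (true; false; if_then_else_)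
open import Data.Fin using (Fin; zero; suc)
open import Data.Fin.Subset using (Subset; _∈_; ∣_∣; ⊥; ∁; ⁅_⁆; _∪_; inside; outside)
open import Data.Fin.Subset.Properties
  using (_∈?_; ∣⊥∣≡0; ∣⁅x⁆∣≡1; ∣p∣≤∣x∷p∣; ∣∁p∣≡n∸∣p∣; x∈⁅x⁆; x∈p∪q⁺; x∉∁p⇒x∈p)
open import Data.Vec using ([]; _∷_)
open import Data.List using (List; []; _∷_; length; filter; tabulate; allFin)
open import Data.List.Properties using (length-tabulate)
open import Data.List.Relation.Unary.All as All using (All; []; _∷_)
open import Data.List.Relation.Unary.All.Properties
  using (tabulate⁺; tabulate⁻; filter⁺; filter⁻; all-filter)
open import Data.List.Extrema.Nat using (argmin; argmax; f[argmin]≤f[xs]; f[xs]≤f[argmax])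
open import Data.Product using (∃; ∃₂; _×_; _,_)
open import Data.Sum using (inj₁; inj₂)
open import Function using (_∘_; id)
open import Relation.Binary.PropositionalEquality
open import Relation.Nullary using (¬_; does; ¬?)
open import Algebra.Properties.CommutativeMonoid.Sum +-0-commutativeMonoid
  using (sum-syntax; sum-cong-≗; sum-replicate-zero; ∑-distrib-+)

∣p∪q∣≤∣p∣+∣q∣ : ∀ {n} (p q : Subset n) → ∣ p ∪ q ∣ ≤ ∣ p ∣ + ∣ q ∣
∣p∪q∣≤∣p∣+∣q∣ []            []            = z≤n
∣p∪q∣≤∣p∣+∣q∣ (inside  ∷ p) (t       ∷ q) =
  s≤s (≤-trans (∣p∪q∣≤∣p∣+∣q∣ p q) (+-monoʳ-≤ ∣ p ∣ (∣p∣≤∣x∷p∣ t q)))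
∣p∪q∣≤∣p∣+∣q∣ (outside ∷ p) (inside  ∷ q) =
  ≤-trans (s≤s (∣p∪q∣≤∣p∣+∣q∣ p q)) (≤-reflexive (sym (+-suc ∣ p ∣ ∣ q ∣)))
∣p∪q∣≤∣p∣+∣q∣ (outside ∷ p) (outside ∷ q) = ∣p∪q∣≤∣p∣+∣q∣ p q

∑[x∈?p]≡∣p∣ : ∀ {n} (p : Subset n) → ∑[ x < n ] (if does (x ∈? p) then 1 else 0) ≡ ∣ p ∣
∑[x∈?p]≡∣p∣ []            = refl
∑[x∈?p]≡∣p∣ (inside  ∷ p) = cong suc (∑[x∈?p]≡∣p∣ p)
∑[x∈?p]≡∣p∣ (outside ∷ p) = ∑[x∈?p]≡∣p∣ p

*-≤-∑ : ∀ {n} a (f : Fin n → ℕ) → (∀ x → a ≤ f x) → n * a ≤ ∑[ x < n ] f x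
*-≤-∑ {zero}  a f a≤f = z≤n
*-≤-∑ {suc n} a f a≤f = +-mono-≤ (a≤f zero) (*-≤-∑ a (f ∘ suc) (a≤f ∘ suc))

^-descent : ∀ N r r′ D j → N * r′ ≤ r * D → r * D ^ suc j < N ^ suc j →
            r′ * D ^ j < N ^ j
^-descent N r r′ D j Nr′≤rD rD^j+1<N^j+1 = *-cancelˡ-< N _ _ (begin-strict
  N * (r′ * D ^ j) ≡⟨ *-assoc N r′ (D ^ j) ⟨
  N * r′ * D ^ j   ≤⟨ *-monoˡ-≤ (D ^ j) Nr′≤rD ⟩
  r * D * D ^ j    ≡⟨ *-assoc r D (D ^ j) ⟩
  r * D ^ suc j    <⟨ rD^j+1<N^j+1 ⟩
  N ^ suc j        ∎)
  where open ≤-Reasoning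

Meets : ∀ {n} → Subset n → Subset n → Set
Meets Y S = ∃ λ x → x ∈ Y × x ∈ S

missing : ∀ {n} → Fin n → List (Subset n) → List (Subset n)
missing x = filter (λ S → x ∈? ∁ S)

length-missing-∷ : ∀ {n} (x : Fin n) S L →
  length (missing x (S ∷ L)) ≡ (if does (x ∈? ∁ S) then 1 else 0) + length (missing x L)
length-missing-∷ x S L with does (x ∈? ∁ S)
... | true  = refl
... | false = refl

∑-length-missing≤ : ∀ {n} D (L : List (Subset n)) → All (λ S → ∣ ∁ S ∣ ≤ D) L →
  ∑[ x < n ] length (missing x L) ≤ length L * D
∑-length-missing≤ {n} D []      []            = ≤-reflexive (sum-replicate-zero n)
∑-length-missing≤ {n} D (S ∷ L) (∣∁S∣≤D ∷ h) = begin
  ∑[ x < n ] length (missing x (S ∷ L))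
    ≡⟨ sum-cong-≗ (λ x → length-missing-∷ x S L) ⟩
  ∑[ x < n ] ((if does (x ∈? ∁ S) then 1 else 0) + length (missing x L))
    ≡⟨ ∑-distrib-+ (λ x → (if does (x ∈? ∁ S) then 1 else 0)) (λ x → length (missing x L)) ⟩
  ∑[ x < n ] (if does (x ∈? ∁ S) then 1 else 0) + ∑[ x < n ] length (missing x L)
    ≤⟨ +-mono-≤ (≤-trans (≤-reflexive (∑[x∈?p]≡∣p∣ (∁ S))) ∣∁S∣≤D) (∑-length-missing≤ D L h) ⟩
  D + length L * D ∎
  where open ≤-Reasoning

fewestMissing : ∀ {n} D (L : List (Subset (suc n))) → All (λ S → ∣ ∁ S ∣ ≤ D) L →
  ∃ λ x → suc n * length (missing x L) ≤ length L * D
fewestMissing {n} D L h =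
  x , ≤-trans (*-≤-∑ _ misses (tabulate⁻ {f = id} (f[argmin]≤f[xs] zero (allFin (suc n)))))
              (∑-length-missing≤ D L h)
  where
  misses : Fin (suc n) → ℕ
  misses y = length (missing y L)
  x : Fin (suc n)
  x = argmin misses zero (allFin (suc n))

meets-⁅x⁆∪ : ∀ {n} (x : Fin n) Y (L : List (Subset n)) →
  All (Meets Y) (missing x L) → All (Meets (⁅ x ⁆ ∪ Y)) L
meets-⁅x⁆∪ x Y L h = filter⁻ (λ S → x ∈? ∁ S) (All.map widen h)
  (All.map meetsAtX (all-filter (¬? ∘ (λ S → x ∈? ∁ S)) L))
  where
  widen : ∀ {S} → Meets Y S → Meets (⁅ x ⁆ ∪ Y) S
  widen (y , y∈Y , y∈S) = y , x∈p∪q⁺ (inj₂ y∈Y) , y∈S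
  meetsAtX : ∀ {S} → ¬ x ∈ ∁ S → Meets (⁅ x ⁆ ∪ Y) S
  meetsAtX x∉∁S = x , x∈p∪q⁺ (inj₁ (x∈⁅x⁆ x)) , x∉∁p⇒x∈p x∉∁S

hittingSet : ∀ {n} D j (L : List (Subset n)) → All (λ S → ∣ ∁ S ∣ ≤ D) L →
  length L * D ^ j < n ^ j → ∃ λ Y → ∣ Y ∣ ≤ j × All (Meets Y) L
hittingSet {n}     D zero    []      _ _ = ⊥ , ≤-reflexive (∣⊥∣≡0 n) , []
hittingSet         D zero    (_ ∷ _) _ (s≤s ())
hittingSet {zero}  D (suc j) L       _ ()
hittingSet {suc n} D (suc j) L small lt =
  let x , few           = fewestMissing D L small
      Y , ∣Y∣≤j , meets = hittingSet D j (missing x L) (filter⁺ (λ S → x ∈? ∁ S) small)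
                                     (^-descent (suc n) (length L) _ D j few lt)
  in  ⁅ x ⁆ ∪ Y ,
      ≤-trans (∣p∪q∣≤∣p∣+∣q∣ ⁅ x ⁆ Y) (+-mono-≤ (≤-reflexive (∣⁅x⁆∣≡1 x)) ∣Y∣≤j) ,
      meets-⁅x⁆∪ x Y L meets

largeSet-1-1 : ∀ k m n (S : Subset n) → LargeSet k m 1 1 n S → m * ∣ ∁ S ∣ ^ k < n ^ k
largeSet-1-1 k m n S = subst₂ _<_
  (trans (*-assoc (1 ^ k) m _) (trans (1^k* _) (cong (λ c → m * c ^ k) (sym (∣∁p∣≡n∸∣p∣ S)))))
  (1^k* (n ^ k))
  where
  1^k* : ∀ a → 1 ^ k * a ≡ a
  1^k* a = trans (cong (_* a) (^-zeroˡ k)) (*-identityˡ a)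

betaAtMost-1-1 : ∀ k m → 1 ≤ m → BetaAtMost m k 1 1
betaAtMost-1-1 k (suc m) _ n A large =
  let Y , ∣Y∣≤k , meets = hittingSet (deficit i₀) k (tabulate A) small fewSets
  in  Y , ∣Y∣≤k , tabulate⁻ {f = A} meets
  where
  deficit : Fin (suc m) → ℕ
  deficit i = ∣ ∁ (A i) ∣
  i₀ : Fin (suc m)
  i₀ = argmax deficit zero (allFin (suc m))
  small : All (λ S → ∣ ∁ S ∣ ≤ deficit i₀) (tabulate A)
  small = tabulate⁺ {f = A} (tabulate⁻ {f = id} (f[xs]≤f[argmax] zero (allFin (suc m))))
  fewSets : length (tabulate A) * deficit i₀ ^ k < n ^ k
  fewSets = subst (λ r → r * deficit i₀ ^ k < n ^ k) (sym (length-tabulate A))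
                  (largeSet-1-1 k (suc m) n (A i₀) (large i₀))

theorem6 : ∀ (k : ℕ) → 1 ≤ k →
    ∃₂ λ (p q : ℕ) → 0 < p × 0 < q ×
      (∀ (m : ℕ) → k ≤ m → BetaAtMost m k p q)
theorem6 k 1≤k = 1 , 1 , s≤s z≤n , s≤s z≤n ,
  λ m k≤m → betaAtMost-1-1 k m (≤-trans 1≤k k≤m)
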